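{- Let $a,b,c$ be positive integers with $\gcd(a,b,c)=1$, where $a$ and $b$ are odd and $c$ is even, and put $S=a+b+c$ and $f(x,y,z)=ax^2+by^2+cz^2$. Then for any positive integer $n$: \begin{itemize} \item if $S\equiv 2\pmod 4$ and $c\equiv 4\pmod 8$, then $t(a,b,c;n)=r(f(x,y,z),8n+S)$; \item if $S\equiv 2\pmod 4$ and $c\not\equiv 4\pmod 8$, then $t(a,b,c;n)=r(f(x,y,y-2z),8n+S)$; \item if $S\equiv 4\pmod 8$ and $c\equiv 2\pmod 4$, then $t(a,b,c;n)=2r(f(x,x-4y,z),8n+S)$; \item if $S\equiv 4\pmod 8$ and $c\equiv 0\pmod 4$, then $t(a,b,c;n)=2r(f(x,x-4y,x-2z),8n+S)$; \item if $S\equiv 0\pmod 8$, then $t(a,b,c;n)=r(f(x,x-2y,x-2z),8n+S)-r\big(f(x,y,z),2n+\tfrac S4\big)$. \end{itemize} Here e.g. $f(x,x-4y,x-2z)$ denotes the ternary quadratic form $ax^2+b(x-4y)^2+c(x-2z)^2$ in the variables $x,y,z$.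
   Context: For positive integers $a,b,c$ and an integer $n$, $t(a,b,c;n)$ denotes the number of $(x,y,z)\in\mathbb Z^3$ with $a\frac{x(x-1)}2+b\frac{y(y-1)}2+c\frac{z(z-1)}2=n$. For a positive definite integral quadratic form $h$ in $k$ variables and an integer $m$, $r(h,m)$ denotes the number of $v\in\mathbb Z^k$ with $h(v)=m$. -}

module Defs where

open import Data.Nat as ℕ using (ℕ)
open import Data.Integer using (ℤ; +_; _+_; _-_; _*_)
open import Data.Fin using (Fin)
open import Data.Product using (Σ; _×_; _,_)
open import Function.Bundles using (_↔_)
open import Relation.Binary.PropositionalEquality using (_≡_)

ℤ³ : Set
ℤ³ = ℤ × ℤ × ℤ

HasCount : (ℤ³ → Set) → ℕ → Set
HasCount P k = Fin k ↔ Σ ℤ³ P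

tri2 : ℤ → ℤ
tri2 x = x * (x - + 1)

-- solution set for t(a,b,c;n):  a x(x-1)/2 + b y(y-1)/2 + c z(z-1)/2 = n,
-- written (equivalently) after multiplying by 2.
TriSol : ℕ → ℕ → ℕ → ℕ → ℤ³ → Set
TriSol a b c n (x , y , z) =
  + a * tri2 x + + b * tri2 y + + c * tri2 z ≡ + (2 ℕ.* n)

t≡ : ℕ → ℕ → ℕ → ℕ → ℕ → Set
t≡ a b c n k = HasCount (TriSol a b c n) k

f : ℕ → ℕ → ℕ → ℤ → ℤ → ℤ → ℤ
f a b c u v w = + a * (u * u) + + b * (v * v) + + c * (w * w)

r≡ : (ℤ³ → ℤ) → ℤ → ℕ → Set
r≡ h m k = HasCount (λ v → h v ≡ m) k

h₁ : ℕ → ℕ → ℕ → ℤ³ → ℤ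
h₁ a b c (x , y , z) = f a b c x y z
h₂ : ℕ → ℕ → ℕ → ℤ³ → ℤ
h₂ a b c (x , y , z) = f a b c x y (y - + 2 * z)
h₃ : ℕ → ℕ → ℕ → ℤ³ → ℤ
h₃ a b c (x , y , z) = f a b c x (x - + 4 * y) z
h₄ : ℕ → ℕ → ℕ → ℤ³ → ℤ
h₄ a b c (x , y , z) = f a b c x (x - + 4 * y) (x - + 2 * z)
h₅ : ℕ → ℕ → ℕ → ℤ³ → ℤ
h₅ a b c (x , y , z) = f a b c x (x - + 2 * y) (x - + 2 * z)

module Submission where

-- The substitution u = 2x - 1 gives  f(2x-1, 2y-1, 2z-1) = 8 (triangular sum) + S
-- with S = a + b + c, so t(a,b,c;n) counts the representations of 8n + S by
-- f(u,v,w) = a u² + b v² + c w² with u, v, w odd.  In each case the congruence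
-- conditions force (some of) the variables of a representation to be odd; this
-- is decided once and for all on residues (a, b, c mod 8, the variables mod 4).
-- The remaining bookkeeping consists of explicit bijections between solution
-- sets: the identity (case 1), y - z ↦ the third variable (case 2), the
-- involution y ↦ 1 - y pairing the two parities of x - y (cases 3 and 4), and a
-- split by the parity of x (case 5), whose even part corresponds to the
-- representations of (8n + S)/4 by f.

open import Defs

module FiniteSets where
  open import Data.Nat as ℕ using (ℕ)
  open import Data.Fin using (Fin; zero; suc)
  open import Data.Fin.Properties using (+↔⊎)
  import Data.Nat.Properties as ℕ
  open import Data.Empty using (⊥; ⊥-elim)
  open import Data.Product using (Σ; _,_; proj₂)
  open import Data.Product.Properties using (Σ-≡,≡→≡)
  open import Data.Sum using (_⊎_; inj₁; inj₂; [_,_]′)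
  open import Data.List using (List; _∷_; length; lookup; filter; deduplicate; map)
  open import Data.List.Membership.Propositional using (_∈_)
  open import Data.List.Membership.Propositional.Properties
    using (∈-filter⁺; ∈-filter⁻; ∈-deduplicate⁺; ∈-lookup; ∈-map⁺)
  import Data.List.Membership.Setoid.Properties as SetoidMembership
  open import Data.List.Relation.Unary.Any using (index)
  open import Data.List.Relation.Unary.Any.Properties using (lookup-index)
  open import Data.List.Relation.Unary.Unique.Propositional using (Unique)
  import Data.List.Relation.Unary.Unique.Propositional.Properties as Unique
  open import Data.List.Relation.Unary.Unique.DecPropositional.Properties using (deduplicate-!)
  open import Function.Bundles using (_↔_; mk↔ₛ′)
  open import Relation.Unary using (Decidable; _∩_)
  open import Relation.Binary.Definitions using (DecidableEquality)
  open import Relation.Binary.PropositionalEquality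
  open import Axiom.UniquenessOfIdentityProofs using (module Decidable⇒UIP)

  ProofIrrelevant : {A : Set} → (A → Set) → Set
  ProofIrrelevant P = ∀ v (p q : P v) → p ≡ q

  Σ-≡ : {A : Set} {P : A → Set} → ProofIrrelevant P →
        {v w : A} {p : P v} {q : P w} → v ≡ w → _≡_ {A = Σ A P} (v , p) (w , q)
  Σ-≡ irr {v} refl = Σ-≡,≡→≡ (refl , irr v _ _)

  ∩-irrelevant : {A : Set} {P Q : A → Set} → ProofIrrelevant P → ProofIrrelevant Q → ProofIrrelevant (P ∩ Q)
  ∩-irrelevant irrP irrQ v (p , q) (p′ , q′) = cong₂ _,_ (irrP v p p′) (irrQ v q q′)

  restrict↔ : {A B : Set} {P : A → Set} {Q : B → Set} → ProofIrrelevant P → ProofIrrelevant Q →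
              (φ : A → B) (ψ : B → A) →
              (∀ {v} → P v → Q (φ v)) → (∀ {w} → Q w → P (ψ w)) →
              (∀ {v} → P v → ψ (φ v) ≡ v) → (∀ {w} → Q w → φ (ψ w) ≡ w) →
              Σ A P ↔ Σ B Q
  restrict↔ irrP irrQ φ ψ PQ QP ψφ φψ = mk↔ₛ′
    (λ { (v , p) → φ v , PQ p }) (λ { (w , q) → ψ w , QP q })
    (λ { (w , q) → Σ-≡ irrQ (φψ q) }) (λ { (v , p) → Σ-≡ irrP (ψφ p) })

  split↔ : {A : Set} {P E O : A → Set} → ProofIrrelevant E → ProofIrrelevant O →
           (∀ v → E v ⊎ O v) → (∀ {v} → E v → O v → ⊥) →
           Σ A P ↔ (Σ A (P ∩ E) ⊎ Σ A (P ∩ O))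
  split↔ {A} {P} {E} {O} irrE irrO E⊎O disjoint = mk↔ₛ′ to from to∘from from∘to
    where
    to : Σ A P → Σ A (P ∩ E) ⊎ Σ A (P ∩ O)
    to (v , p) = [ (λ e → inj₁ (v , p , e)) , (λ o → inj₂ (v , p , o)) ]′ (E⊎O v)
    from : Σ A (P ∩ E) ⊎ Σ A (P ∩ O) → Σ A P
    from (inj₁ (v , p , _)) = v , p
    from (inj₂ (v , p , _)) = v , p
    to∘from : ∀ s → to (from s) ≡ s
    to∘from (inj₁ (v , p , e)) with E⊎O v
    ... | inj₁ e′ = cong (λ e → inj₁ (v , p , e)) (irrE v e′ e)
    ... | inj₂ o  = ⊥-elim (disjoint e o)
    to∘from (inj₂ (v , p , o)) with E⊎O v
    ... | inj₁ e  = ⊥-elim (disjoint e o)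
    ... | inj₂ o′ = cong (λ o → inj₂ (v , p , o)) (irrO v o′ o)
    from∘to : ∀ s → from (to s) ≡ s
    from∘to (v , p) with E⊎O v
    ... | inj₁ _ = refl
    ... | inj₂ _ = refl

  Fin-double : ∀ k → Fin (2 ℕ.* k) ↔ (Fin k ⊎ Fin k)
  Fin-double k = subst (λ j → Fin (k ℕ.+ j) ↔ (Fin k ⊎ Fin k)) (sym (ℕ.+-identityʳ k)) +↔⊎

  index-∈-lookup : {A : Set} (xs : List A) (i : Fin (length xs)) → index (∈-lookup {xs = xs} i) ≡ i
  index-∈-lookup (x ∷ xs) zero    = refl
  index-∈-lookup (x ∷ xs) (suc i) = cong suc (index-∈-lookup xs i)

  count-covered : {A : Set} {P : A → Set} → DecidableEquality A → Decidable P → ProofIrrelevant P →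
                  (L : List A) → (∀ {v} → P v → v ∈ L) → Σ ℕ λ k → Fin k ↔ Σ A P
  count-covered {A} {P} _≟_ P? irrP L cover = length L′ , mk↔ₛ′ to from to∘from from∘to
    where
    L′ : List A
    L′ = filter P? (deduplicate _≟_ L)
    unique : Unique L′
    unique = Unique.filter⁺ P? (deduplicate-! _≟_ L)
    member : ∀ {v} → P v → v ∈ L′
    member p = ∈-filter⁺ P? (∈-deduplicate⁺ _≟_ (cover p)) p
    to : Fin (length L′) → Σ A P
    to i = lookup L′ i , proj₂ (∈-filter⁻ P? {xs = deduplicate _≟_ L} (∈-lookup i))
    from : Σ A P → Fin (length L′)
    from (v , p) = index (member p)
    to∘from : ∀ s → to (from s) ≡ s
    to∘from (v , p) = Σ-≡ irrP (sym (lookup-index (member p)))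
    member-irrelevant : ∀ {v} (p q : v ∈ L′) → p ≡ q
    member-irrelevant = SetoidMembership.unique⇒irrelevant (setoid A) (Decidable⇒UIP.≡-irrelevant _≟_) unique
    from∘to : ∀ i → from (to i) ≡ i
    from∘to i = trans (cong index (member-irrelevant (member _) (∈-lookup i))) (index-∈-lookup L′ i)

  cover-by-retraction : {A B : Set} {P : A → Set} {Q : B → Set} (L : List A) →
                        (∀ {v} → P v → v ∈ L) → (ψ : B → A) (φ : A → B) →
                        (∀ {w} → Q w → P (ψ w)) → (∀ w → φ (ψ w) ≡ w) →
                        ∀ {w} → Q w → w ∈ map φ L
  cover-by-retraction L cover ψ φ QP φψ {w} q = subst (_∈ map φ L) (φψ w) (∈-map⁺ φ (cover (QP q)))

module Congruences where
  open import Data.Nat as ℕ using (ℕ; suc; NonZero)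
  import Data.Nat.DivMod as ℕ
  open import Data.Integer using (ℤ; +_; -[1+_]; _+_; _-_; _*_; -_; _%ℕ_; _/ℕ_)
  import Data.Integer.Properties as ℤ
  open import Data.Integer.DivMod using (a≡a%ℕn+[a/ℕn]*n)
  open import Data.Integer.Tactic.RingSolver using (solve-∀)
  open import Algebra.Bundles using (AbelianGroup)
  open import Algebra.Properties.Group (AbelianGroup.group ℤ.+-0-abelianGroup) using (∙-cancelˡ)
  open import Data.Product using (_×_; _,_)
  open import Relation.Binary.PropositionalEquality
  open ≡-Reasoning

  infix 4 _≡_mod_

  data _≡_mod_ (x y : ℤ) (d : ℕ) : Set where
    quotient : (k : ℤ) → x ≡ y + k * + d → x ≡ y mod d

  ≡⇒mod : ∀ {x y d} → x ≡ y → x ≡ y mod d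
  ≡⇒mod {y = y} {d} refl = quotient (+ 0) (sym (ℤ.+-identityʳ y))

  mod-sym : ∀ {x y d} → x ≡ y mod d → y ≡ x mod d
  mod-sym {y = y} {d} (quotient k refl) = quotient (- k) (identity y k (+ d))
    where
    identity : ∀ y k D → y ≡ y + k * D + - k * D
    identity = solve-∀

  mod-trans : ∀ {x y z d} → x ≡ y mod d → y ≡ z mod d → x ≡ z mod d
  mod-trans {z = z} {d} (quotient k refl) (quotient l refl) = quotient (l + k) (identity z l k (+ d))
    where
    identity : ∀ z l k D → z + l * D + k * D ≡ z + (l + k) * D
    identity = solve-∀

  mod-+ : ∀ {x x′ y y′ d} → x ≡ x′ mod d → y ≡ y′ mod d → x + y ≡ x′ + y′ mod d
  mod-+ {x′ = x′} {y′ = y′} {d} (quotient k refl) (quotient l refl) = quotient (k + l) (identity x′ y′ k l (+ d))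
    where
    identity : ∀ x′ y′ k l D → x′ + k * D + (y′ + l * D) ≡ x′ + y′ + (k + l) * D
    identity = solve-∀

  mod-* : ∀ {x x′ y y′ d} → x ≡ x′ mod d → y ≡ y′ mod d → x * y ≡ x′ * y′ mod d
  mod-* {x′ = x′} {y′ = y′} {d} (quotient k refl) (quotient l refl) =
    quotient (x′ * l + k * y′ + k * l * + d) (identity x′ y′ k l (+ d))
    where
    identity : ∀ x′ y′ k l D → (x′ + k * D) * (y′ + l * D) ≡ x′ * y′ + (x′ * l + k * y′ + k * l * D) * D
    identity = solve-∀

  mod-square : ∀ {x y} → x ≡ y mod 4 → x * x ≡ y * y mod 8
  mod-square {y = y} (quotient k refl) = quotient (y * k + + 2 * k * k) (identity y k)
    where
    identity : ∀ y k → (y + k * + 4) * (y + k * + 4) ≡ y * y + (y * k + + 2 * k * k) * + 8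
    identity = solve-∀

  mod-weaken : ∀ {x y} e d → x ≡ y mod e ℕ.* d → x ≡ y mod d
  mod-weaken {y = y} e d (quotient k refl) = quotient (k * + e) (begin
    y + k * + (e ℕ.* d)   ≡⟨ cong (λ t → y + k * t) (ℤ.pos-* e d) ⟩
    y + k * (+ e * + d)   ≡⟨ cong (λ t → y + t) (sym (ℤ.*-assoc k (+ e) (+ d))) ⟩
    y + k * + e * + d     ∎)

  mod-ℕ : ∀ {X Y d} .{{_ : NonZero d}} → + X ≡ + Y mod d → X ℕ.% d ≡ Y ℕ.% d
  mod-ℕ {X} {Y} {d} (quotient (+ j) e) = shift-remainder (trans e (cast Y j))
    where
    cast : ∀ Y j → + Y + + j * + d ≡ + (Y ℕ.+ j ℕ.* d)
    cast Y j = trans (cong (λ t → + Y + t) (sym (ℤ.pos-* j d))) (sym (ℤ.pos-+ Y (j ℕ.* d)))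
    shift-remainder : + X ≡ + (Y ℕ.+ j ℕ.* d) → X ℕ.% d ≡ Y ℕ.% d
    shift-remainder e = trans (cong (ℕ._% d) (ℤ.+-injective e)) (ℕ.[m+kn]%n≡m%n Y j d)
  mod-ℕ {X} {Y} {d} (quotient -[1+ j ] e) = sym (mod-ℕ (quotient (+ suc j) (trans (identity (+ Y) -[1+ j ] (+ d))
                                                       (cong (λ t → t + + suc j * + d) (sym e)))))
    where
    identity : ∀ Y k D → Y ≡ Y + k * D + - k * D
    identity = solve-∀

  residue-ℕ : ∀ a d .{{_ : NonZero d}} → + a ≡ + (a ℕ.% d) mod d
  residue-ℕ a d = quotient (+ (a ℕ./ d)) (begin
    + a                                   ≡⟨ cong +_ (ℕ.m≡m%n+[m/n]*n a d) ⟩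
    + (a ℕ.% d ℕ.+ a ℕ./ d ℕ.* d)         ≡⟨ ℤ.pos-+ (a ℕ.% d) _ ⟩
    + (a ℕ.% d) + + (a ℕ./ d ℕ.* d)       ≡⟨ cong (λ t → + (a ℕ.% d) + t) (ℤ.pos-* (a ℕ./ d) d) ⟩
    + (a ℕ.% d) + + (a ℕ./ d) * + d       ∎)

  residue-ℤ : ∀ u d .{{_ : NonZero d}} → u ≡ + (u %ℕ d) mod d
  residue-ℤ u d = quotient (u /ℕ d) (a≡a%ℕn+[a/ℕn]*n u d)

  divmod-unique : ∀ {u d r k} .{{_ : NonZero d}} → r ℕ.< d → u ≡ + r + k * + d →
                  u %ℕ d ≡ r × u /ℕ d ≡ k
  divmod-unique {u} {d} {r} {k} r<d e = same-remainder , same-quotient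
    where
    e′ : u ≡ + (u %ℕ d) + u /ℕ d * + d
    e′ = a≡a%ℕn+[a/ℕn]*n u d
    same-remainder : u %ℕ d ≡ r
    same-remainder = begin
      u %ℕ d          ≡⟨ sym (ℕ.m<n⇒m%n≡m (Data.Integer.DivMod.n%ℕd<d u d)) ⟩
      u %ℕ d ℕ.% d    ≡⟨ mod-ℕ (mod-trans (mod-sym (residue-ℤ u d)) (quotient k e)) ⟩
      r ℕ.% d         ≡⟨ ℕ.m<n⇒m%n≡m r<d ⟩
      r               ∎
    same-quotient : u /ℕ d ≡ k
    same-quotient = ℤ.*-cancelʳ-≡ (u /ℕ d) k (+ d) (∙-cancelˡ (+ r) _ _ (begin
      + r + u /ℕ d * + d          ≡⟨ cong (λ t → + t + u /ℕ d * + d) (sym same-remainder) ⟩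
      + (u %ℕ d) + u /ℕ d * + d   ≡⟨ sym e′ ⟩
      u                           ≡⟨ e ⟩
      + r + k * + d               ∎))

module Parity where
  open import Data.Nat as ℕ using (suc)
  import Data.Nat.Properties as ℕ
  open import Data.Integer using (ℤ; +_; _+_; _-_; _*_; _%ℕ_; _/ℕ_)
  import Data.Integer.Properties as ℤ
  open import Data.Integer.DivMod using (a≡a%ℕn+[a/ℕn]*n; n%ℕd<d)
  open import Data.Integer.Tactic.RingSolver using (solve-∀)
  open import Data.Empty using (⊥)
  open import Relation.Nullary.Decidable using (Dec; map′)
  open import Data.Product using (_×_; proj₁; proj₂)
  open import Data.Sum using (_⊎_; inj₁; inj₂)
  open import Relation.Binary.PropositionalEquality
  open ≡-Reasoning
  open Congruences

  record Even (u : ℤ) : Set where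
    constructor even
    field remainder : u %ℕ 2 ≡ 0

  record Odd (u : ℤ) : Set where
    constructor odd
    field remainder : u %ℕ 2 ≡ 1

  even-irrelevant : ∀ {u} (p q : Even u) → p ≡ q
  even-irrelevant (even p) (even q) = cong even (ℕ.≡-irrelevant p q)

  odd-irrelevant : ∀ {u} (p q : Odd u) → p ≡ q
  odd-irrelevant (odd p) (odd q) = cong odd (ℕ.≡-irrelevant p q)

  even? : ∀ u → Dec (Even u)
  even? u = map′ even Even.remainder (u %ℕ 2 ℕ.≟ 0)

  parity : ∀ u → Even u ⊎ Odd u
  parity u with u %ℕ 2 in eq | n%ℕd<d u 2
  ... | 0           | _ = inj₁ (even eq)
  ... | 1           | _ = inj₂ (odd eq)
  ... | suc (suc _) | ℕ.s≤s (ℕ.s≤s ())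

  even-odd-disjoint : ∀ {u} → Even u → Odd u → ⊥
  even-odd-disjoint (even e) (odd o) with trans (sym e) o
  ... | ()

  halve-even : ∀ k → (+ 2 * k) %ℕ 2 ≡ 0 × (+ 2 * k) /ℕ 2 ≡ k
  halve-even k = divmod-unique {r = 0} {k = k} (ℕ.s≤s ℕ.z≤n) (identity k)
    where
    identity : ∀ k → + 2 * k ≡ + 0 + k * + 2
    identity = solve-∀

  halve-odd : ∀ k → (+ 2 * k + + 1) %ℕ 2 ≡ 1 × (+ 2 * k + + 1) /ℕ 2 ≡ k
  halve-odd k = divmod-unique {r = 1} {k = k} (ℕ.s≤s (ℕ.s≤s ℕ.z≤n)) (identity k)
    where
    identity : ∀ k → + 2 * k + + 1 ≡ + 1 + k * + 2
    identity = solve-∀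

  even-intro : ∀ {u} k → u ≡ + 2 * k → Even u
  even-intro k refl = even (proj₁ (halve-even k))

  odd-intro : ∀ {u} k → u ≡ + 2 * k + + 1 → Odd u
  odd-intro k refl = odd (proj₁ (halve-odd k))

  half-double : ∀ k → (+ 2 * k) /ℕ 2 ≡ k
  half-double k = proj₂ (halve-even k)

  halves : ∀ u → u ≡ + 2 * (u /ℕ 2) + + (u %ℕ 2)
  halves u = trans (a≡a%ℕn+[a/ℕn]*n u 2) (identity (+ (u %ℕ 2)) (u /ℕ 2))
    where
    identity : ∀ r q → r + q * + 2 ≡ + 2 * q + r
    identity = solve-∀

  even-half : ∀ {u} → Even u → u ≡ + 2 * (u /ℕ 2)
  even-half {u} (even e) =
    trans (halves u) (trans (cong (λ r → + 2 * (u /ℕ 2) + + r) e) (ℤ.+-identityʳ (+ 2 * (u /ℕ 2))))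

  odd-half : ∀ {u} → Odd u → u ≡ + 2 * (u /ℕ 2) + + 1
  odd-half {u} (odd o) = trans (halves u) (cong (λ r → + 2 * (u /ℕ 2) + + r) o)

  residue-odd : ∀ {u r} → u ≡ + r mod 4 → r ℕ.% 2 ≡ 1 → Odd u
  residue-odd {u} {r} u≡r r-odd with mod-trans (mod-weaken 2 2 u≡r) (residue-ℕ r 2)
  ... | quotient k e = odd-intro k (trans e (trans (cong (λ s → + s + k * + 2) r-odd) (identity k)))
    where
    identity : ∀ k → + 1 + k * + 2 ≡ + 2 * k + + 1
    identity = solve-∀

  odd-rep : ℤ → ℤ
  odd-rep x = + 2 * x - + 1

  odd-index : ℤ → ℤ
  odd-index u = u /ℕ 2 + + 1

  odd-rep-as-double : ∀ x → + 2 * x - + 1 ≡ + 2 * (x - + 1) + + 1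
  odd-rep-as-double = solve-∀

  odd-rep-odd : ∀ x → Odd (odd-rep x)
  odd-rep-odd x = odd-intro (x - + 1) (odd-rep-as-double x)

  odd-index-rep : ∀ x → odd-index (odd-rep x) ≡ x
  odd-index-rep x = begin
    odd-rep x /ℕ 2 + + 1                    ≡⟨ cong (λ t → t /ℕ 2 + + 1) (odd-rep-as-double x) ⟩
    (+ 2 * (x - + 1) + + 1) /ℕ 2 + + 1      ≡⟨ cong (_+ + 1) (proj₂ (halve-odd (x - + 1))) ⟩
    x - + 1 + + 1                           ≡⟨ identity x ⟩
    x                                       ∎
    where
    identity : ∀ x → x - + 1 + + 1 ≡ x
    identity = solve-∀

  odd-rep-index : ∀ {u} → Odd u → odd-rep (odd-index u) ≡ u
  odd-rep-index {u} o = trans (identity (u /ℕ 2)) (sym (odd-half o))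
    where
    identity : ∀ k → + 2 * (k + + 1) - + 1 ≡ + 2 * k + + 1
    identity = solve-∀

  odd-rep-shift : ∀ t s → + 2 * (t - s) - + 1 ≡ (+ 2 * t - + 1) - + 2 * s
  odd-rep-shift = solve-∀

module ResiduePatterns where
  open import Data.Nat using (ℕ; zero; suc; _+_; _*_; _%_; _<_; NonZero)
  open import Data.Nat.Properties using (_≟_; m<1+n⇒m<n∨m≡n)
  open import Data.Bool using (Bool; true; _∧_; T)
  open import Data.Bool.Properties using (T-∧)
  open import Data.Unit using (tt)
  open import Function.Bundles using (Equivalence)
  open import Data.Nat.DivMod using (m∣n⇒o%n%m≡o%m)
  open import Data.Nat.Divisibility using (_∣_)
  open import Data.Product using (_×_; _,_)
  open import Data.Sum using (inj₁; inj₂)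
  open import Relation.Nullary.Decidable using (Dec; isYes; toWitness; _→-dec_; _×-dec_)
  open import Relation.Binary.PropositionalEquality

  %-divisor : ∀ {x y} d m .{{_ : NonZero d}} .{{_ : NonZero m}} → d ∣ m → x % m ≡ y % m → x % d ≡ y % d
  %-divisor {x} {y} d m d∣m e =
    trans (sym (m∣n⇒o%n%m≡o%m d m x d∣m)) (trans (cong (_% d) e) (m∣n⇒o%n%m≡o%m d m y d∣m))

  -- Bounded quantification over ℕ as a boolean, so that the type checker can
  -- evaluate it without constructing proofs.
  every< : ℕ → (ℕ → Bool) → Bool
  every< zero    p = true
  every< (suc n) p = p n ∧ every< n p

  every<-sound : ∀ {n} (p : ℕ → Bool) {k} → T (every< n p) → k < n → T (p k)
  every<-sound {suc n} p t k<1+n with Equivalence.to T-∧ t | m<1+n⇒m<n∨m≡n k<1+n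
  ... | pn , _    | inj₂ refl = pn
  ... | _ , rest  | inj₁ k<n  = every<-sound p rest k<n

  every<²-sound : ∀ {m n} (p : ℕ → ℕ → Bool) {i j} →
                  T (every< m λ i → every< n (p i)) → i < m → j < n → T (p i j)
  every<²-sound {n = n} p t i< j< =
    every<-sound (p _) (every<-sound (λ i → every< n (p i)) t i<) j<

  every<³-sound : ∀ {l m n} (p : ℕ → ℕ → ℕ → Bool) {i j k} →
                  T (every< l λ i → every< m λ j → every< n (p i j)) → i < l → j < m → k < n → T (p i j k)
  every<³-sound {m = m} {n} p t i< j< k< =
    every<²-sound (p _) (every<-sound (λ i → every< m λ j → every< n (p i j)) t i<) j< k<

  check⁶ : {P : ℕ → ℕ → ℕ → ℕ → ℕ → ℕ → Set} (P? : ∀ a b c x y z → Dec (P a b c x y z)) →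
           T (every< 8 λ a → every< 8 λ b → every< 8 λ c →
              every< 4 λ x → every< 4 λ y → every< 4 λ z → isYes (P? a b c x y z)) →
           ∀ {a b c x y z} → a < 8 → b < 8 → c < 8 → x < 4 → y < 4 → z < 4 → P a b c x y z
  check⁶ P? table {a} {b} {c} {x} {y} {z} a< b< c< x< y< z< = toWitness {a? = P? a b c x y z}
    (every<³-sound (λ x y z → isYes (P? a b c x y z))
      (every<³-sound (λ a b c → every< 4 λ x → every< 4 λ y → every< 4 λ z → isYes (P? a b c x y z))
        table a< b< c<) x< y< z<)

  check⁵ : {P : ℕ → ℕ → ℕ → ℕ → ℕ → Set} (P? : ∀ a b c x z → Dec (P a b c x z)) →
           T (every< 8 λ a → every< 8 λ b → every< 8 λ c → every< 4 λ x → every< 4 λ z → isYes (P? a b c x z)) →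
           ∀ {a b c x z} → a < 8 → b < 8 → c < 8 → x < 4 → z < 4 → P a b c x z
  check⁵ P? table {a} {b} {c} {x} {z} a< b< c< x< z< = toWitness {a? = P? a b c x z}
    (every<²-sound (λ x z → isYes (P? a b c x z))
      (every<³-sound (λ a b c → every< 4 λ x → every< 4 λ z → isYes (P? a b c x z)) table a< b< c<) x< z<)

  SquareSum≡ : ℕ → ℕ → ℕ → ℕ → ℕ → ℕ → Set
  SquareSum≡ a b c u v w = (a * (u * u) + b * (v * v) + c * (w * w)) % 8 ≡ (a + b + c) % 8

  -- For each case of the theorem: the variables forced to be odd in a
  -- representation, in terms of the residues of a, b, c modulo 8 and of the
  -- variables modulo 4 (the square of u mod 8 only depends on u mod 4).
  Pattern₁ : ℕ → ℕ → ℕ → ℕ → ℕ → ℕ → Set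
  Pattern₁ a b c x y z = a % 2 ≡ 1 → b % 2 ≡ 1 → c % 8 ≡ 4 → (a + b + c) % 4 ≡ 2 →
    SquareSum≡ a b c x y z → x % 2 ≡ 1 × y % 2 ≡ 1 × z % 2 ≡ 1

  pattern₁ : ∀ {a b c x y z} → a < 8 → b < 8 → c < 8 → x < 4 → y < 4 → z < 4 → Pattern₁ a b c x y z
  pattern₁ = check⁶ {Pattern₁} (λ a b c x y z →
    _ ≟ _ →-dec _ ≟ _ →-dec _ ≟ _ →-dec _ ≟ _ →-dec _ ≟ _ →-dec _ ≟ _ ×-dec _ ≟ _ ×-dec _ ≟ _) tt

  -- in case 2 the last variable y - 2z is congruent to y + 2z modulo 4
  Pattern₂ : ℕ → ℕ → ℕ → ℕ → ℕ → ℕ → Set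
  Pattern₂ a b c x y z = a % 2 ≡ 1 → b % 2 ≡ 1 → c % 2 ≡ 0 → (a + b + c) % 4 ≡ 2 →
    SquareSum≡ a b c x y (y + 2 * z) → x % 2 ≡ 1 × y % 2 ≡ 1

  pattern₂ : ∀ {a b c x y z} → a < 8 → b < 8 → c < 8 → x < 4 → y < 4 → z < 4 → Pattern₂ a b c x y z
  pattern₂ = check⁶ {Pattern₂} (λ a b c x y z →
    _ ≟ _ →-dec _ ≟ _ →-dec _ ≟ _ →-dec _ ≟ _ →-dec _ ≟ _ →-dec _ ≟ _ ×-dec _ ≟ _) tt

  -- in cases 3 and 4 the middle variable x - 4y is congruent to x modulo 4
  Pattern₃ : ℕ → ℕ → ℕ → ℕ → ℕ → Set
  Pattern₃ a b c x z = a % 2 ≡ 1 → b % 2 ≡ 1 → c % 4 ≡ 2 → (a + b + c) % 8 ≡ 4 →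
    SquareSum≡ a b c x x z → x % 2 ≡ 1 × z % 2 ≡ 1

  pattern₃ : ∀ {a b c x z} → a < 8 → b < 8 → c < 8 → x < 4 → z < 4 → Pattern₃ a b c x z
  pattern₃ = check⁵ {Pattern₃} (λ a b c x z →
    _ ≟ _ →-dec _ ≟ _ →-dec _ ≟ _ →-dec _ ≟ _ →-dec _ ≟ _ →-dec _ ≟ _ ×-dec _ ≟ _) tt

  Pattern₄ : ℕ → ℕ → ℕ → ℕ → ℕ → Set
  Pattern₄ a b c x z = a % 2 ≡ 1 → b % 2 ≡ 1 → c % 4 ≡ 0 → (a + b + c) % 8 ≡ 4 →
    SquareSum≡ a b c x x (x + 2 * z) → x % 2 ≡ 1

  pattern₄ : ∀ {a b c x z} → a < 8 → b < 8 → c < 8 → x < 4 → z < 4 → Pattern₄ a b c x z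
  pattern₄ = check⁵ {Pattern₄} (λ a b c x z → _ ≟ _ →-dec _ ≟ _ →-dec _ ≟ _ →-dec _ ≟ _ →-dec _ ≟ _ →-dec _ ≟ _) tt

module Forms where
  open import Data.Nat as ℕ using (ℕ)
  import Data.Nat.Properties as ℕ
  import Data.Nat.DivMod as ℕ
  open import Data.Nat.Divisibility using (_∣_; divides; ∣-refl; m∣m*n)
  open import Data.Integer using (ℤ; +_; _+_; _-_; _*_)
  import Data.Integer.Properties as ℤ
  open import Data.Integer.DivMod using (n%ℕd<d)
  open import Data.Integer.Tactic.RingSolver using (solve-∀)
  open import Data.Product using (_×_; _,_)
  open import Relation.Binary.PropositionalEquality
  open ≡-Reasoning
  open Congruences
  open Parity
  open ResiduePatterns

  target : ℕ → ℕ → ℕ → ℕ → ℤ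
  target a b c n = + (8 ℕ.* n ℕ.+ (a ℕ.+ b ℕ.+ c))

  target-quarter : ∀ a b c n → 4 ∣ a ℕ.+ b ℕ.+ c →
                   + 4 * + (2 ℕ.* n ℕ.+ (a ℕ.+ b ℕ.+ c) ℕ./ 4) ≡ target a b c n
  target-quarter a b c n 4∣S = trans (sym (ℤ.pos-* 4 (2 ℕ.* n ℕ.+ S ℕ./ 4))) (cong +_ (begin
    4 ℕ.* (2 ℕ.* n ℕ.+ S ℕ./ 4)          ≡⟨ ℕ.*-distribˡ-+ 4 (2 ℕ.* n) (S ℕ./ 4) ⟩
    4 ℕ.* (2 ℕ.* n) ℕ.+ 4 ℕ.* (S ℕ./ 4)  ≡⟨ cong₂ ℕ._+_ (sym (ℕ.*-assoc 4 2 n)) (ℕ.m*[n/m]≡n 4∣S) ⟩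
    8 ℕ.* n ℕ.+ S                        ∎))
    where
    S : ℕ
    S = a ℕ.+ b ℕ.+ c

  f-cong : ∀ a b c {u u′ v v′ w w′} → u ≡ u′ → v ≡ v′ → w ≡ w′ → f a b c u v w ≡ f a b c u′ v′ w′
  f-cong a b c refl refl refl = refl

  f-cast : ∀ a b c u v w →
           f a b c (+ u) (+ v) (+ w) ≡ + (a ℕ.* (u ℕ.* u) ℕ.+ b ℕ.* (v ℕ.* v) ℕ.+ c ℕ.* (w ℕ.* w))
  f-cast a b c u v w = sym (begin
    + (A ℕ.+ B ℕ.+ C)            ≡⟨ ℤ.pos-+ (A ℕ.+ B) C ⟩
    + (A ℕ.+ B) + + C            ≡⟨ cong (_+ + C) (ℤ.pos-+ A B) ⟩
    + A + + B + + C              ≡⟨ cong₂ _+_ (cong₂ _+_ (term a u) (term b v)) (term c w) ⟩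
    f a b c (+ u) (+ v) (+ w)    ∎)
    where
    A : ℕ
    A = a ℕ.* (u ℕ.* u)
    B : ℕ
    B = b ℕ.* (v ℕ.* v)
    C : ℕ
    C = c ℕ.* (w ℕ.* w)
    term : ∀ a u → + (a ℕ.* (u ℕ.* u)) ≡ + a * (+ u * + u)
    term a u = trans (ℤ.pos-* a (u ℕ.* u)) (cong (+ a *_) (ℤ.pos-* u u))

  sum-residues : ∀ a b c → (a ℕ.% 8 ℕ.+ b ℕ.% 8 ℕ.+ c ℕ.% 8) ℕ.% 8 ≡ (a ℕ.+ b ℕ.+ c) ℕ.% 8
  sum-residues a b c = begin
    (a ℕ.% 8 ℕ.+ b ℕ.% 8 ℕ.+ c ℕ.% 8) ℕ.% 8                 ≡⟨ ℕ.%-distribˡ-+ (a ℕ.% 8 ℕ.+ b ℕ.% 8) (c ℕ.% 8) 8 ⟩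
    ((a ℕ.% 8 ℕ.+ b ℕ.% 8) ℕ.% 8 ℕ.+ c ℕ.% 8 ℕ.% 8) ℕ.% 8   ≡⟨ cong₂ (λ s t → (s ℕ.+ t) ℕ.% 8)
                                                                  (sym (ℕ.%-distribˡ-+ a b 8)) (ℕ.m%n%n≡m%n c 8) ⟩
    ((a ℕ.+ b) ℕ.% 8 ℕ.+ c ℕ.% 8) ℕ.% 8                     ≡⟨ sym (ℕ.%-distribˡ-+ (a ℕ.+ b) c 8) ⟩
    (a ℕ.+ b ℕ.+ c) ℕ.% 8                                   ∎

  residue-criterion : ∀ a b c n {u v w} x y z → u ≡ + x mod 4 → v ≡ + y mod 4 → w ≡ + z mod 4 →
                      f a b c u v w ≡ target a b c n → SquareSum≡ (a ℕ.% 8) (b ℕ.% 8) (c ℕ.% 8) x y z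
  residue-criterion a b c n {u} {v} {w} x y z u≡x v≡y w≡z eq = begin
    F ℕ.% 8                                       ≡⟨ mod-ℕ (mod-trans (≡⇒mod (sym (f-cast a₈ b₈ c₈ x y z)))
                                                       (mod-trans (mod-sym reduce) (≡⇒mod eq))) ⟩
    (8 ℕ.* n ℕ.+ (a ℕ.+ b ℕ.+ c)) ℕ.% 8           ≡⟨ ℕ.%-remove-+ˡ (a ℕ.+ b ℕ.+ c) (m∣m*n n) ⟩
    (a ℕ.+ b ℕ.+ c) ℕ.% 8                         ≡⟨ sym (sum-residues a b c) ⟩
    (a₈ ℕ.+ b₈ ℕ.+ c₈) ℕ.% 8                       ∎
    where
    a₈ : ℕ
    a₈ = a ℕ.% 8
    b₈ : ℕ
    b₈ = b ℕ.% 8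
    c₈ : ℕ
    c₈ = c ℕ.% 8
    F : ℕ
    F = a₈ ℕ.* (x ℕ.* x) ℕ.+ b₈ ℕ.* (y ℕ.* y) ℕ.+ c₈ ℕ.* (z ℕ.* z)
    reduce : f a b c u v w ≡ f a₈ b₈ c₈ (+ x) (+ y) (+ z) mod 8
    reduce = mod-+ (mod-+ (mod-* (residue-ℕ a 8) (mod-square u≡x)) (mod-* (residue-ℕ b 8) (mod-square v≡y)))
                   (mod-* (residue-ℕ c 8) (mod-square w≡z))

  mod-sub-quadruple : ∀ {x r} y → x ≡ + r mod 4 → x - + 4 * y ≡ + r mod 4
  mod-sub-quadruple {r = r} y (quotient k refl) = quotient (k - y) (identity (+ r) k y)
    where
    identity : ∀ r k y → r + k * + 4 - + 4 * y ≡ r + (k - y) * + 4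
    identity = solve-∀

  mod-sub-double : ∀ {y z r s} → y ≡ + r mod 4 → z ≡ + s mod 4 → y - + 2 * z ≡ + (r ℕ.+ 2 ℕ.* s) mod 4
  mod-sub-double {r = r} {s} (quotient k refl) (quotient l refl) = quotient (k - + 2 * l - + s) (begin
    + r + k * + 4 - + 2 * (+ s + l * + 4)         ≡⟨ identity (+ r) (+ s) k l ⟩
    + r + + 2 * + s + (k - + 2 * l - + s) * + 4    ≡⟨ cong (_+ (k - + 2 * l - + s) * + 4) cast ⟩
    + (r ℕ.+ 2 ℕ.* s) + (k - + 2 * l - + s) * + 4  ∎)
    where
    identity : ∀ r s k l → r + k * + 4 - + 2 * (s + l * + 4) ≡ r + + 2 * s + (k - + 2 * l - s) * + 4
    identity = solve-∀
    cast : + r + + 2 * + s ≡ + (r ℕ.+ 2 ℕ.* s)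
    cast = sym (trans (ℤ.pos-+ r (2 ℕ.* s)) (cong (λ t → + r + t) (ℤ.pos-* 2 s)))

  residue-hyp : ∀ x d .{{_ : ℕ.NonZero d}} → d ∣ 8 → x ℕ.% 8 ℕ.% d ≡ x ℕ.% d
  residue-hyp x d d∣8 = %-divisor d 8 d∣8 (ℕ.m%n%n≡m%n x 8)

  sum-residue-hyp : ∀ a b c d .{{_ : ℕ.NonZero d}} → d ∣ 8 →
                    (a ℕ.% 8 ℕ.+ b ℕ.% 8 ℕ.+ c ℕ.% 8) ℕ.% d ≡ (a ℕ.+ b ℕ.+ c) ℕ.% d
  sum-residue-hyp a b c d d∣8 = %-divisor d 8 d∣8 (sum-residues a b c)

  odd-variables₁ : ∀ a b c n → a ℕ.% 2 ≡ 1 → b ℕ.% 2 ≡ 1 → c ℕ.% 8 ≡ 4 →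
                   (a ℕ.+ b ℕ.+ c) ℕ.% 4 ≡ 2 → ∀ u v w → f a b c u v w ≡ target a b c n → Odd u × Odd v × Odd w
  odd-variables₁ a b c n ha hb hc hS u v w eq =
    let ou , ov , ow = pattern₁ (ℕ.m%n<n a 8) (ℕ.m%n<n b 8) (ℕ.m%n<n c 8) (n%ℕd<d u 4) (n%ℕd<d v 4) (n%ℕd<d w 4)
          (trans (residue-hyp a 2 (divides 4 refl)) ha) (trans (residue-hyp b 2 (divides 4 refl)) hb)
          (trans (residue-hyp c 8 ∣-refl) hc) (trans (sum-residue-hyp a b c 4 (divides 2 refl)) hS)
          (residue-criterion a b c n _ _ _ (residue-ℤ u 4) (residue-ℤ v 4) (residue-ℤ w 4) eq)
    in residue-odd (residue-ℤ u 4) ou , residue-odd (residue-ℤ v 4) ov , residue-odd (residue-ℤ w 4) ow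

  odd-variables₂ : ∀ a b c n → a ℕ.% 2 ≡ 1 → b ℕ.% 2 ≡ 1 → c ℕ.% 2 ≡ 0 →
                   (a ℕ.+ b ℕ.+ c) ℕ.% 4 ≡ 2 → ∀ x y z → h₂ a b c (x , y , z) ≡ target a b c n → Odd x × Odd y
  odd-variables₂ a b c n ha hb hc hS x y z eq =
    let ox , oy = pattern₂ (ℕ.m%n<n a 8) (ℕ.m%n<n b 8) (ℕ.m%n<n c 8) (n%ℕd<d x 4) (n%ℕd<d y 4) (n%ℕd<d z 4)
          (trans (residue-hyp a 2 (divides 4 refl)) ha) (trans (residue-hyp b 2 (divides 4 refl)) hb)
          (trans (residue-hyp c 2 (divides 4 refl)) hc) (trans (sum-residue-hyp a b c 4 (divides 2 refl)) hS)
          (residue-criterion a b c n _ _ _ (residue-ℤ x 4) (residue-ℤ y 4)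
            (mod-sub-double (residue-ℤ y 4) (residue-ℤ z 4)) eq)
    in residue-odd (residue-ℤ x 4) ox , residue-odd (residue-ℤ y 4) oy

  odd-variables₃ : ∀ a b c n → a ℕ.% 2 ≡ 1 → b ℕ.% 2 ≡ 1 → c ℕ.% 4 ≡ 2 →
                   (a ℕ.+ b ℕ.+ c) ℕ.% 8 ≡ 4 → ∀ x y z → h₃ a b c (x , y , z) ≡ target a b c n → Odd x × Odd z
  odd-variables₃ a b c n ha hb hc hS x y z eq =
    let ox , oz = pattern₃ (ℕ.m%n<n a 8) (ℕ.m%n<n b 8) (ℕ.m%n<n c 8) (n%ℕd<d x 4) (n%ℕd<d z 4)
          (trans (residue-hyp a 2 (divides 4 refl)) ha) (trans (residue-hyp b 2 (divides 4 refl)) hb)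
          (trans (residue-hyp c 4 (divides 2 refl)) hc) (trans (sum-residue-hyp a b c 8 ∣-refl) hS)
          (residue-criterion a b c n _ _ _ (residue-ℤ x 4) (mod-sub-quadruple y (residue-ℤ x 4))
            (residue-ℤ z 4) eq)
    in residue-odd (residue-ℤ x 4) ox , residue-odd (residue-ℤ z 4) oz

  odd-variables₄ : ∀ a b c n → a ℕ.% 2 ≡ 1 → b ℕ.% 2 ≡ 1 → c ℕ.% 4 ≡ 0 →
                   (a ℕ.+ b ℕ.+ c) ℕ.% 8 ≡ 4 → ∀ x y z → h₄ a b c (x , y , z) ≡ target a b c n → Odd x
  odd-variables₄ a b c n ha hb hc hS x y z eq =
    residue-odd (residue-ℤ x 4) (pattern₄ (ℕ.m%n<n a 8) (ℕ.m%n<n b 8) (ℕ.m%n<n c 8) (n%ℕd<d x 4) (n%ℕd<d z 4)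
      (trans (residue-hyp a 2 (divides 4 refl)) ha) (trans (residue-hyp b 2 (divides 4 refl)) hb)
      (trans (residue-hyp c 4 (divides 2 refl)) hc) (trans (sum-residue-hyp a b c 8 ∣-refl) hS)
      (residue-criterion a b c n _ _ _ (residue-ℤ x 4) (mod-sub-quadruple y (residue-ℤ x 4))
        (mod-sub-double (residue-ℤ x 4) (residue-ℤ z 4)) eq))

module SolutionSets where
  open import Data.Nat as ℕ using (ℕ)
  import Data.Nat.Properties as ℕ
  open import Data.Integer using (ℤ; +_; _+_; _-_; _*_; _/ℕ_)
  import Data.Integer.Properties as ℤ
  open import Data.Integer.Tactic.RingSolver using (solve-∀)
  open import Algebra.Bundles using (AbelianGroup)
  open import Algebra.Properties.Group (AbelianGroup.group ℤ.+-0-abelianGroup) using (∙-cancelʳ)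
  open import Data.Product using (Σ; _×_; _,_)
  open import Data.Sum using (_⊎_; swap)
  open import Relation.Unary using (_∩_)
  open import Function.Bundles using (_↔_)
  open import Relation.Binary.PropositionalEquality
  open import Axiom.UniquenessOfIdentityProofs using (module Decidable⇒UIP)
  open ≡-Reasoning
  open FiniteSets
  open Parity
  open Forms

  ℤ-irrelevant : {x y : ℤ} (p q : x ≡ y) → p ≡ q
  ℤ-irrelevant = Decidable⇒UIP.≡-irrelevant ℤ._≟_

  triple-≡ : ∀ {x x′ y y′ z z′ : ℤ} → x ≡ x′ → y ≡ y′ → z ≡ z′ → _≡_ {A = ℤ³} (x , y , z) (x′ , y′ , z′)
  triple-≡ refl refl refl = refl

  Tri : ℕ → ℕ → ℕ → ℕ → Set
  Tri a b c n = Σ ℤ³ (TriSol a b c n)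

  Reps : (ℤ³ → ℤ) → ℤ → Set
  Reps h m = Σ ℤ³ λ v → h v ≡ m

  tri-irrelevant : ∀ a b c n → ProofIrrelevant (TriSol a b c n)
  tri-irrelevant a b c n (x , y , z) = ℤ-irrelevant

  reps-irrelevant : ∀ (h : ℤ³ → ℤ) m → ProofIrrelevant λ v → h v ≡ m
  reps-irrelevant h m v = ℤ-irrelevant

  odd-square-identity : ∀ (A B C x y z : ℤ) →
    A * ((+ 2 * x - + 1) * (+ 2 * x - + 1)) + B * ((+ 2 * y - + 1) * (+ 2 * y - + 1)) + C * ((+ 2 * z - + 1) * (+ 2 * z - + 1))
    ≡ + 4 * (A * (x * (x - + 1)) + B * (y * (y - + 1)) + C * (z * (z - + 1))) + (A + B + C)
  odd-square-identity = solve-∀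

  target-split : ∀ a b c n → target a b c n ≡ + 4 * + (2 ℕ.* n) + (+ a + + b + + c)
  target-split a b c n = begin
    + (8 ℕ.* n ℕ.+ (a ℕ.+ b ℕ.+ c))          ≡⟨ ℤ.pos-+ (8 ℕ.* n) (a ℕ.+ b ℕ.+ c) ⟩
    + (8 ℕ.* n) + + (a ℕ.+ b ℕ.+ c)          ≡⟨ cong₂ _+_ (trans (cong +_ (ℕ.*-assoc 4 2 n)) (ℤ.pos-* 4 (2 ℕ.* n))) (ℤ.pos-+ (a ℕ.+ b) c) ⟩
    + 4 * + (2 ℕ.* n) + (+ (a ℕ.+ b) + + c)  ≡⟨ cong (λ s → + 4 * + (2 ℕ.* n) + (s + + c)) (ℤ.pos-+ a b) ⟩
    + 4 * + (2 ℕ.* n) + (+ a + + b + + c)    ∎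

  tri→odd : ∀ a b c n x y z → TriSol a b c n (x , y , z) →
            f a b c (odd-rep x) (odd-rep y) (odd-rep z) ≡ target a b c n
  tri→odd a b c n x y z p = begin
    f a b c (odd-rep x) (odd-rep y) (odd-rep z)                       ≡⟨ odd-square-identity (+ a) (+ b) (+ c) x y z ⟩
    + 4 * (+ a * tri2 x + + b * tri2 y + + c * tri2 z) + (+ a + + b + + c) ≡⟨ cong (λ t → + 4 * t + (+ a + + b + + c)) p ⟩
    + 4 * + (2 ℕ.* n) + (+ a + + b + + c)                             ≡⟨ sym (target-split a b c n) ⟩
    target a b c n                                                    ∎

  odd→tri : ∀ a b c n x y z → f a b c (odd-rep x) (odd-rep y) (odd-rep z) ≡ target a b c n →
            TriSol a b c n (x , y , z)
  odd→tri a b c n x y z q = ℤ.*-cancelˡ-≡ (+ 4) _ _ (∙-cancelʳ (+ a + + b + + c) _ _ (begin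
    + 4 * (+ a * tri2 x + + b * tri2 y + + c * tri2 z) + (+ a + + b + + c) ≡⟨ sym (odd-square-identity (+ a) (+ b) (+ c) x y z) ⟩
    f a b c (odd-rep x) (odd-rep y) (odd-rep z)                       ≡⟨ q ⟩
    target a b c n                                                    ≡⟨ target-split a b c n ⟩
    + 4 * + (2 ℕ.* n) + (+ a + + b + + c)                             ∎))

  sub-sub : ∀ t s → t - (t - s) ≡ s
  sub-sub = solve-∀

  odd-rep-sub : ∀ t s → (+ 2 * t - + 1) - + 2 * (t - s) ≡ + 2 * s - + 1
  odd-rep-sub = solve-∀

  tri↔h₁ : ∀ a b c n → (∀ u v w → f a b c u v w ≡ target a b c n → Odd u × Odd v × Odd w) →
           Tri a b c n ↔ Reps (h₁ a b c) (target a b c n)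
  tri↔h₁ a b c n odd-vars = restrict↔ {P = TriSol a b c n} {Q = λ v → h₁ a b c v ≡ target a b c n}
    (tri-irrelevant a b c n) (reps-irrelevant (h₁ a b c) (target a b c n))
    (λ { (x , y , z) → odd-rep x , odd-rep y , odd-rep z })
    (λ { (u , v , w) → odd-index u , odd-index v , odd-index w })
    (λ { {x , y , z} p → tri→odd a b c n x y z p })
    (λ { {u , v , w} q → odd→tri a b c n (odd-index u) (odd-index v) (odd-index w) (trans (backward u v w (odd-vars u v w q)) q) })
    (λ { {x , y , z} _ → triple-≡ (odd-index-rep x) (odd-index-rep y) (odd-index-rep z) })
    (λ { {u , v , w} q → let ou , ov , ow = odd-vars u v w q in
         triple-≡ (odd-rep-index ou) (odd-rep-index ov) (odd-rep-index ow) })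
    where
    backward : ∀ u v w → Odd u × Odd v × Odd w →
               f a b c (odd-rep (odd-index u)) (odd-rep (odd-index v)) (odd-rep (odd-index w)) ≡ f a b c u v w
    backward u v w (ou , ov , ow) = f-cong a b c (odd-rep-index ou) (odd-rep-index ov) (odd-rep-index ow)

  tri↔h₂ : ∀ a b c n → (∀ x y z → h₂ a b c (x , y , z) ≡ target a b c n → Odd x × Odd y) →
           Tri a b c n ↔ Reps (h₂ a b c) (target a b c n)
  tri↔h₂ a b c n odd-vars = restrict↔ {P = TriSol a b c n} {Q = λ v → h₂ a b c v ≡ target a b c n}
    (tri-irrelevant a b c n) (reps-irrelevant (h₂ a b c) (target a b c n))
    (λ { (x , y , z) → odd-rep x , odd-rep y , y - z })
    (λ { (X , Y , Z) → odd-index X , odd-index Y , odd-index Y - Z })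
    (λ { {x , y , z} p → trans (forward x y z) (tri→odd a b c n x y z p) })
    (λ { {X , Y , Z} q → odd→tri a b c n (odd-index X) (odd-index Y) (odd-index Y - Z)
                           (trans (backward X Y Z (odd-vars X Y Z q)) q) })
    (λ { {x , y , z} _ → triple-≡ (odd-index-rep x) (odd-index-rep y)
                           (trans (cong (_- (y - z)) (odd-index-rep y)) (sub-sub y z)) })
    (λ { {X , Y , Z} q → let oX , oY = odd-vars X Y Z q in
         triple-≡ (odd-rep-index oX) (odd-rep-index oY) (sub-sub (odd-index Y) Z) })
    where
    forward : ∀ x y z → h₂ a b c (odd-rep x , odd-rep y , y - z) ≡ f a b c (odd-rep x) (odd-rep y) (odd-rep z)
    forward x y z = cong (f a b c (odd-rep x) (odd-rep y)) (odd-rep-sub y z)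
    backward : ∀ X Y Z → Odd X × Odd Y →
               f a b c (odd-rep (odd-index X)) (odd-rep (odd-index Y)) (odd-rep (odd-index Y - Z)) ≡ h₂ a b c (X , Y , Z)
    backward X Y Z (oX , oY) = f-cong a b c (odd-rep-index oX) (odd-rep-index oY)
      (trans (odd-rep-shift (odd-index Y) Z) (cong (_- + 2 * Z) (odd-rep-index oY)))

  EvenDiff OddDiff : ℤ³ → Set
  EvenDiff (x , y , _) = Even (x - y)
  OddDiff  (x , y , _) = Odd (x - y)

  even-diff-irrelevant : ProofIrrelevant EvenDiff
  even-diff-irrelevant (x , y , z) = even-irrelevant

  odd-diff-irrelevant : ProofIrrelevant OddDiff
  odd-diff-irrelevant (x , y , z) = odd-irrelevant

  tri-split : ∀ a b c n → Tri a b c n ↔ (Σ ℤ³ (TriSol a b c n ∩ EvenDiff) ⊎ Σ ℤ³ (TriSol a b c n ∩ OddDiff))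
  tri-split a b c n = split↔ {P = TriSol a b c n} {E = EvenDiff} {O = OddDiff}
    even-diff-irrelevant odd-diff-irrelevant
    (λ { (x , y , z) → parity (x - y) }) (λ { {x , y , z} → even-odd-disjoint })

  reflect-tri2 : ∀ y → (+ 1 - y) * ((+ 1 - y) - + 1) ≡ y * (y - + 1)
  reflect-tri2 = solve-∀

  reflect-twice : ∀ y → + 1 - (+ 1 - y) ≡ y
  reflect-twice = solve-∀

  reflect-diff : ∀ x y → x - (+ 1 - y) ≡ (x - y) + + 2 * y - + 1
  reflect-diff = solve-∀

  reflect-odd→even : ∀ x y → Odd (x - y) → Even (x - (+ 1 - y))
  reflect-odd→even x y o = even-intro (h + y) (begin
    x - (+ 1 - y)                          ≡⟨ reflect-diff x y ⟩
    (x - y) + + 2 * y - + 1                ≡⟨ cong (λ t → t + + 2 * y - + 1) (odd-half o) ⟩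
    + 2 * h + + 1 + + 2 * y - + 1          ≡⟨ identity h y ⟩
    + 2 * (h + y)                          ∎)
    where
    h : ℤ
    h = (x - y) /ℕ 2
    identity : ∀ h y → + 2 * h + + 1 + + 2 * y - + 1 ≡ + 2 * (h + y)
    identity = solve-∀

  reflect-even→odd : ∀ x y → Even (x - y) → Odd (x - (+ 1 - y))
  reflect-even→odd x y e = odd-intro (h + y - + 1) (begin
    x - (+ 1 - y)                          ≡⟨ reflect-diff x y ⟩
    (x - y) + + 2 * y - + 1                ≡⟨ cong (λ t → t + + 2 * y - + 1) (even-half e) ⟩
    + 2 * h + + 2 * y - + 1                ≡⟨ identity h y ⟩
    + 2 * (h + y - + 1) + + 1              ∎)
    where
    h : ℤ
    h = (x - y) /ℕ 2
    identity : ∀ h y → + 2 * h + + 2 * y - + 1 ≡ + 2 * (h + y - + 1) + + 1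
    identity = solve-∀

  tri-odd↔tri-even : ∀ a b c n → Σ ℤ³ (TriSol a b c n ∩ OddDiff) ↔ Σ ℤ³ (TriSol a b c n ∩ EvenDiff)
  tri-odd↔tri-even a b c n = restrict↔ {P = TriSol a b c n ∩ OddDiff} {Q = TriSol a b c n ∩ EvenDiff}
    (∩-irrelevant {P = TriSol a b c n} (tri-irrelevant a b c n) odd-diff-irrelevant)
    (∩-irrelevant {P = TriSol a b c n} (tri-irrelevant a b c n) even-diff-irrelevant)
    reflect reflect
    (λ { {x , y , z} (p , o) → trans (reflected-sum x y z) p , reflect-odd→even x y o })
    (λ { {x , y , z} (p , e) → trans (reflected-sum x y z) p , reflect-even→odd x y e })
    (λ { {x , y , z} _ → cong (λ t → x , t , z) (reflect-twice y) })
    (λ { {x , y , z} _ → cong (λ t → x , t , z) (reflect-twice y) })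
    where
    reflect : ℤ³ → ℤ³
    reflect (x , y , z) = x , + 1 - y , z
    reflected-sum : ∀ x y z → + a * tri2 x + + b * tri2 (+ 1 - y) + + c * tri2 z ≡ + a * tri2 x + + b * tri2 y + + c * tri2 z
    reflected-sum x y z = cong (λ t → + a * tri2 x + + b * t + + c * tri2 z) (reflect-tri2 y)

  odd-rep-sub-even : ∀ x y → Even (x - y) → (+ 2 * x - + 1) - + 4 * ((x - y) /ℕ 2) ≡ + 2 * y - + 1
  odd-rep-sub-even x y e = begin
    (+ 2 * x - + 1) - + 4 * h              ≡⟨ identity (+ 2 * x - + 1) h ⟩
    (+ 2 * x - + 1) - + 2 * (+ 2 * h)      ≡⟨ cong (λ t → (+ 2 * x - + 1) - + 2 * t) (sym (even-half e)) ⟩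
    (+ 2 * x - + 1) - + 2 * (x - y)        ≡⟨ odd-rep-sub x y ⟩
    + 2 * y - + 1                          ∎
    where
    h : ℤ
    h = (x - y) /ℕ 2
    identity : ∀ t h → t - + 4 * h ≡ t - + 2 * (+ 2 * h)
    identity = solve-∀

  odd-index-sub-double : ∀ {X} Y → Odd X → (+ 2 * (odd-index X - + 2 * Y) - + 1) ≡ X - + 4 * Y
  odd-index-sub-double {X} Y oX = begin
    + 2 * (odd-index X - + 2 * Y) - + 1            ≡⟨ odd-rep-shift (odd-index X) (+ 2 * Y) ⟩
    odd-rep (odd-index X) - + 2 * (+ 2 * Y)        ≡⟨ cong (λ t → t - + 2 * (+ 2 * Y)) (odd-rep-index oX) ⟩
    X - + 2 * (+ 2 * Y)                            ≡⟨ identity X Y ⟩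
    X - + 4 * Y                                    ∎
    where
    identity : ∀ X Y → X - + 2 * (+ 2 * Y) ≡ X - + 4 * Y
    identity = solve-∀

  even-diff-sub-double : ∀ t Y → Even (t - (t - + 2 * Y))
  even-diff-sub-double t Y = even-intro Y (sub-sub t (+ 2 * Y))

  half-diff-sub-double : ∀ t Y → (t - (t - + 2 * Y)) /ℕ 2 ≡ Y
  half-diff-sub-double t Y = trans (cong (_/ℕ 2) (sub-sub t (+ 2 * Y))) (half-double Y)

  sub-half-diff : ∀ x y → Even (x - y) → x - + 2 * ((x - y) /ℕ 2) ≡ y
  sub-half-diff x y e = trans (cong (x -_) (sym (even-half e))) (sub-sub x y)

  tri-even↔h₃ : ∀ a b c n → (∀ x y z → h₃ a b c (x , y , z) ≡ target a b c n → Odd x × Odd z) →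
                Σ ℤ³ (TriSol a b c n ∩ EvenDiff) ↔ Reps (h₃ a b c) (target a b c n)
  tri-even↔h₃ a b c n odd-vars = restrict↔ {P = TriSol a b c n ∩ EvenDiff} {Q = λ v → h₃ a b c v ≡ target a b c n}
    (∩-irrelevant (tri-irrelevant a b c n) even-diff-irrelevant) (reps-irrelevant (h₃ a b c) (target a b c n))
    (λ { (x , y , z) → odd-rep x , (x - y) /ℕ 2 , odd-rep z })
    (λ { (X , Y , Z) → odd-index X , odd-index X - + 2 * Y , odd-index Z })
    (λ { {x , y , z} (p , e) → trans (cong (λ t → f a b c (odd-rep x) t (odd-rep z)) (odd-rep-sub-even x y e))
                                    (tri→odd a b c n x y z p) })
    (λ { {X , Y , Z} q → let oX , oZ = odd-vars X Y Z q in
         odd→tri a b c n (odd-index X) (odd-index X - + 2 * Y) (odd-index Z)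
           (trans (f-cong a b c (odd-rep-index oX) (odd-index-sub-double Y oX) (odd-rep-index oZ)) q)
         , even-diff-sub-double (odd-index X) Y })
    (λ { {x , y , z} (_ , e) → triple-≡ (odd-index-rep x)
           (trans (cong (λ t → t - + 2 * ((x - y) /ℕ 2)) (odd-index-rep x)) (sub-half-diff x y e)) (odd-index-rep z) })
    (λ { {X , Y , Z} q → let oX , oZ = odd-vars X Y Z q in
         triple-≡ (odd-rep-index oX) (half-diff-sub-double (odd-index X) Y) (odd-rep-index oZ) })

  tri-even↔h₄ : ∀ a b c n → (∀ x y z → h₄ a b c (x , y , z) ≡ target a b c n → Odd x) →
                Σ ℤ³ (TriSol a b c n ∩ EvenDiff) ↔ Reps (h₄ a b c) (target a b c n)
  tri-even↔h₄ a b c n odd-var = restrict↔ {P = TriSol a b c n ∩ EvenDiff} {Q = λ v → h₄ a b c v ≡ target a b c n}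
    (∩-irrelevant (tri-irrelevant a b c n) even-diff-irrelevant) (reps-irrelevant (h₄ a b c) (target a b c n))
    (λ { (x , y , z) → odd-rep x , (x - y) /ℕ 2 , x - z })
    (λ { (X , Y , Z) → odd-index X , odd-index X - + 2 * Y , odd-index X - Z })
    (λ { {x , y , z} (p , e) → trans (cong₂ (f a b c (odd-rep x)) (odd-rep-sub-even x y e) (odd-rep-sub x z))
                                    (tri→odd a b c n x y z p) })
    (λ { {X , Y , Z} q → let oX = odd-var X Y Z q in
         odd→tri a b c n (odd-index X) (odd-index X - + 2 * Y) (odd-index X - Z)
           (trans (f-cong a b c (odd-rep-index oX) (odd-index-sub-double Y oX)
                    (trans (odd-rep-shift (odd-index X) Z) (cong (_- + 2 * Z) (odd-rep-index oX)))) q)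
         , even-diff-sub-double (odd-index X) Y })
    (λ { {x , y , z} (_ , e) → triple-≡ (odd-index-rep x)
           (trans (cong (λ t → t - + 2 * ((x - y) /ℕ 2)) (odd-index-rep x)) (sub-half-diff x y e))
           (trans (cong (_- (x - z)) (odd-index-rep x)) (sub-sub x z)) })
    (λ { {X , Y , Z} q → triple-≡ (odd-rep-index (odd-var X Y Z q)) (half-diff-sub-double (odd-index X) Y)
                                   (sub-sub (odd-index X) Z) })

  EvenHead OddHead : ℤ³ → Set
  EvenHead (x , _ , _) = Even x
  OddHead  (x , _ , _) = Odd x

  even-head-irrelevant : ProofIrrelevant EvenHead
  even-head-irrelevant (x , y , z) = even-irrelevant

  odd-head-irrelevant : ProofIrrelevant OddHead
  odd-head-irrelevant (x , y , z) = odd-irrelevant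

  h₅-split : ∀ a b c m → Reps (h₅ a b c) m ↔
             (Σ ℤ³ ((λ v → h₅ a b c v ≡ m) ∩ OddHead) ⊎ Σ ℤ³ ((λ v → h₅ a b c v ≡ m) ∩ EvenHead))
  h₅-split a b c m = split↔ {P = λ v → h₅ a b c v ≡ m} {E = OddHead} {O = EvenHead}
    odd-head-irrelevant even-head-irrelevant
    (λ { (x , y , z) → swap (parity x) }) (λ { {x , y , z} o e → even-odd-disjoint e o })

  tri↔h₅-odd : ∀ a b c n → Tri a b c n ↔ Σ ℤ³ ((λ v → h₅ a b c v ≡ target a b c n) ∩ OddHead)
  tri↔h₅-odd a b c n = restrict↔ {P = TriSol a b c n} {Q = (λ v → h₅ a b c v ≡ target a b c n) ∩ OddHead}
    (tri-irrelevant a b c n) (∩-irrelevant (reps-irrelevant (h₅ a b c) (target a b c n)) odd-head-irrelevant)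
    (λ { (x , y , z) → odd-rep x , x - y , x - z })
    (λ { (X , Y , Z) → odd-index X , odd-index X - Y , odd-index X - Z })
    (λ { {x , y , z} p → trans (cong₂ (f a b c (odd-rep x)) (odd-rep-sub x y) (odd-rep-sub x z)) (tri→odd a b c n x y z p)
                       , odd-rep-odd x })
    (λ { {X , Y , Z} (q , oX) → odd→tri a b c n (odd-index X) (odd-index X - Y) (odd-index X - Z)
           (trans (f-cong a b c (odd-rep-index oX) (shifted oX Y) (shifted oX Z)) q) })
    (λ { {x , y , z} _ → triple-≡ (odd-index-rep x)
           (trans (cong (_- (x - y)) (odd-index-rep x)) (sub-sub x y))
           (trans (cong (_- (x - z)) (odd-index-rep x)) (sub-sub x z)) })
    (λ { {X , Y , Z} (_ , oX) → triple-≡ (odd-rep-index oX) (sub-sub (odd-index X) Y) (sub-sub (odd-index X) Z) })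
    where
    shifted : ∀ {X} → Odd X → ∀ Y → + 2 * (odd-index X - Y) - + 1 ≡ X - + 2 * Y
    shifted {X} oX Y = trans (odd-rep-shift (odd-index X) Y) (cong (_- + 2 * Y) (odd-rep-index oX))

  f-double : ∀ a b c u v w → f a b c (+ 2 * u) (+ 2 * v) (+ 2 * w) ≡ + 4 * f a b c u v w
  f-double a b c = identity (+ a) (+ b) (+ c)
    where
    identity : ∀ A B C u v w → A * ((+ 2 * u) * (+ 2 * u)) + B * ((+ 2 * v) * (+ 2 * v)) + C * ((+ 2 * w) * (+ 2 * w))
                               ≡ + 4 * (A * (u * u) + B * (v * v) + C * (w * w))
    identity = solve-∀

  double-sub : ∀ t s → + 2 * t - + 2 * (t - s) ≡ + 2 * s
  double-sub = solve-∀

  h₁↔h₅-even : ∀ a b c {m m′} → + 4 * m′ ≡ m →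
               Reps (h₁ a b c) m′ ↔ Σ ℤ³ ((λ v → h₅ a b c v ≡ m) ∩ EvenHead)
  h₁↔h₅-even a b c {m} {m′} m≡4m′ = restrict↔ {P = λ v → h₁ a b c v ≡ m′} {Q = (λ v → h₅ a b c v ≡ m) ∩ EvenHead}
    (reps-irrelevant (h₁ a b c) m′) (∩-irrelevant (reps-irrelevant (h₅ a b c) m) even-head-irrelevant)
    (λ { (u , v , w) → + 2 * u , u - v , u - w })
    (λ { (X , Y , Z) → X /ℕ 2 , X /ℕ 2 - Y , X /ℕ 2 - Z })
    (λ { {u , v , w} q → (begin
           f a b c (+ 2 * u) (+ 2 * u - + 2 * (u - v)) (+ 2 * u - + 2 * (u - w)) ≡⟨ cong₂ (f a b c (+ 2 * u)) (double-sub u v) (double-sub u w) ⟩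
           f a b c (+ 2 * u) (+ 2 * v) (+ 2 * w)                               ≡⟨ f-double a b c u v w ⟩
           + 4 * f a b c u v w                                                 ≡⟨ cong (+ 4 *_) q ⟩
           + 4 * m′                                                            ≡⟨ m≡4m′ ⟩
           m                                                                   ∎)
         , even-intro u refl })
    (λ { {X , Y , Z} (q , eX) → ℤ.*-cancelˡ-≡ (+ 4) _ _ (begin
           + 4 * f a b c (X /ℕ 2) (X /ℕ 2 - Y) (X /ℕ 2 - Z)                    ≡⟨ sym (f-double a b c (X /ℕ 2) (X /ℕ 2 - Y) (X /ℕ 2 - Z)) ⟩
           f a b c (+ 2 * (X /ℕ 2)) (+ 2 * (X /ℕ 2 - Y)) (+ 2 * (X /ℕ 2 - Z)) ≡⟨ f-cong a b c (sym (even-half eX))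
                                                                                  (doubled eX Y) (doubled eX Z) ⟩
           f a b c X (X - + 2 * Y) (X - + 2 * Z)                              ≡⟨ q ⟩
           m                                                                   ≡⟨ sym m≡4m′ ⟩
           + 4 * m′                                                            ∎) })
    (λ { {u , v , w} _ → triple-≡ (half-double u)
           (trans (cong (_- (u - v)) (half-double u)) (sub-sub u v))
           (trans (cong (_- (u - w)) (half-double u)) (sub-sub u w)) })
    (λ { {X , Y , Z} (_ , eX) → triple-≡ (sym (even-half eX)) (sub-sub (X /ℕ 2) Y) (sub-sub (X /ℕ 2) Z) })
    where
    doubled : ∀ {X} → Even X → ∀ Y → + 2 * (X /ℕ 2 - Y) ≡ X - + 2 * Y
    doubled {X} eX Y = trans (identity (X /ℕ 2) Y) (cong (_- + 2 * Y) (sym (even-half eX)))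
      where
      identity : ∀ h Y → + 2 * (h - Y) ≡ + 2 * h - + 2 * Y
      identity = solve-∀

module Counting where
  open import Data.Nat as ℕ using (ℕ; zero; suc; s≤s)
  open import Data.Product.Properties using (≡-dec)
  open import Relation.Binary.Definitions using (DecidableEquality)
  import Data.Nat.Properties as ℕ
  open import Data.Integer using (ℤ; +_; -[1+_]; ∣_∣; _+_; _-_; _*_)
  import Data.Integer.Properties as ℤ
  open import Data.Fin using (Fin)
  open import Data.Product using (Σ; _,_)
  open import Data.Sum using (inj₁; inj₂)
  open import Data.List using (List; []; _∷_; map; cartesianProduct)
  open import Data.List.Membership.Propositional using (_∈_)
  open import Data.List.Membership.Propositional.Properties using (∈-cartesianProduct⁺)
  open import Data.List.Relation.Unary.Any using (here; there)
  open import Function.Bundles using (_↔_)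
  open import Relation.Unary using (_∩_)
  open import Relation.Nullary.Decidable using (Dec; _×-dec_)
  open import Relation.Binary.PropositionalEquality
  open FiniteSets
  open Parity
  open Forms
  open SolutionSets

  -- The solution sets are finite: every representation of M by f lies in a
  -- box of integer triples, and the triangular solutions are covered by the
  -- images of such a box.

  _≟³_ : DecidableEquality ℤ³
  _≟³_ = ≡-dec ℤ._≟_ (≡-dec ℤ._≟_ ℤ._≟_)

  interval : ℕ → List ℤ
  interval zero    = + 0 ∷ []
  interval (suc B) = + suc B ∷ -[1+ B ] ∷ interval B

  ∈-interval : ∀ B u → ∣ u ∣ ℕ.≤ B → u ∈ interval B
  ∈-interval zero    (+ zero)  _ = here refl
  ∈-interval zero    (+ suc _) ()
  ∈-interval zero    -[1+ _ ]  ()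
  ∈-interval (suc B) u le with ℕ.m≤n⇒m<n∨m≡n le
  ∈-interval (suc B) (+ .(suc B)) _ | inj₂ refl = here refl
  ∈-interval (suc B) -[1+ .B ]    _ | inj₂ refl = there (here refl)
  ∈-interval (suc B) u            _ | inj₁ (s≤s lt) = there (there (∈-interval B u lt))

  box : ℕ → List ℤ³
  box B = cartesianProduct (interval B) (cartesianProduct (interval B) (interval B))

  square-abs : ∀ u → u * u ≡ + ∣ u ∣ * + ∣ u ∣
  square-abs (+ _)    = refl
  square-abs -[1+ _ ] = refl

  f-abs : ∀ a b c u v w →
          f a b c u v w ≡ + (a ℕ.* (∣ u ∣ ℕ.* ∣ u ∣) ℕ.+ b ℕ.* (∣ v ∣ ℕ.* ∣ v ∣) ℕ.+ c ℕ.* (∣ w ∣ ℕ.* ∣ w ∣))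
  f-abs a b c u v w = trans
    (cong₂ _+_ (cong₂ _+_ (cong (λ t → + a * t) (square-abs u)) (cong (λ t → + b * t) (square-abs v)))
                            (cong (λ t → + c * t) (square-abs w)))
    (f-cast a b c (∣ u ∣) (∣ v ∣) (∣ w ∣))

  ≤-weighted-square : ∀ k {a} → 1 ℕ.≤ a → k ℕ.≤ a ℕ.* (k ℕ.* k)
  ≤-weighted-square zero    _ = ℕ.z≤n
  ≤-weighted-square (suc k) {suc a} _ = ℕ.≤-trans (ℕ.m≤m*n (suc k) (suc k)) (ℕ.m≤n*m (suc k ℕ.* suc k) (suc a))

  h₁-cover : ∀ {a b c} → 1 ℕ.≤ a → 1 ℕ.≤ b → 1 ℕ.≤ c → ∀ {M v} → h₁ a b c v ≡ M → v ∈ box ∣ M ∣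
  h₁-cover {a} {b} {c} ha hb hc {M} {u , v , w} eq =
    ∈-cartesianProduct⁺ (∈-interval _ u u≤M) (∈-cartesianProduct⁺ (∈-interval _ v v≤M) (∈-interval _ w w≤M))
    where
    A : ℕ
    A = a ℕ.* (∣ u ∣ ℕ.* ∣ u ∣)
    B : ℕ
    B = b ℕ.* (∣ v ∣ ℕ.* ∣ v ∣)
    C : ℕ
    C = c ℕ.* (∣ w ∣ ℕ.* ∣ w ∣)
    M≡ : ∣ M ∣ ≡ A ℕ.+ B ℕ.+ C
    M≡ = cong ∣_∣ (trans (sym eq) (f-abs a b c u v w))
    u≤M : ∣ u ∣ ℕ.≤ ∣ M ∣
    u≤M = subst (∣ u ∣ ℕ.≤_) (sym M≡)
      (ℕ.≤-trans (≤-weighted-square ∣ u ∣ ha) (ℕ.≤-trans (ℕ.m≤m+n A B) (ℕ.m≤m+n (A ℕ.+ B) C)))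
    v≤M : ∣ v ∣ ℕ.≤ ∣ M ∣
    v≤M = subst (∣ v ∣ ℕ.≤_) (sym M≡)
      (ℕ.≤-trans (≤-weighted-square ∣ v ∣ hb) (ℕ.≤-trans (ℕ.m≤n+m B A) (ℕ.m≤m+n (A ℕ.+ B) C)))
    w≤M : ∣ w ∣ ℕ.≤ ∣ M ∣
    w≤M = subst (∣ w ∣ ℕ.≤_) (sym M≡) (ℕ.≤-trans (≤-weighted-square ∣ w ∣ hc) (ℕ.m≤n+m C (A ℕ.+ B)))

  count-h₁ : ∀ a b c → 1 ℕ.≤ a → 1 ℕ.≤ b → 1 ℕ.≤ c → ∀ M → Σ ℕ (r≡ (h₁ a b c) M)
  count-h₁ a b c ha hb hc M =
    count-covered _≟³_ (λ v → h₁ a b c v ℤ.≟ M) (reps-irrelevant (h₁ a b c) M) (box ∣ M ∣) (h₁-cover ha hb hc)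

  odd-index³ : ℤ³ → ℤ³
  odd-index³ (u , v , w) = odd-index u , odd-index v , odd-index w

  tri-candidates : ℕ → ℕ → ℕ → ℕ → List ℤ³
  tri-candidates a b c n = map odd-index³ (box ∣ target a b c n ∣)

  tri-cover : ∀ {a b c} n → 1 ℕ.≤ a → 1 ℕ.≤ b → 1 ℕ.≤ c → ∀ {v} → TriSol a b c n v → v ∈ tri-candidates a b c n
  tri-cover {a} {b} {c} n ha hb hc = cover-by-retraction (box ∣ target a b c n ∣) (h₁-cover ha hb hc)
    (λ { (x , y , z) → odd-rep x , odd-rep y , odd-rep z }) odd-index³
    (λ { {x , y , z} p → tri→odd a b c n x y z p })
    (λ { (x , y , z) → triple-≡ (odd-index-rep x) (odd-index-rep y) (odd-index-rep z) })

  tri? : ∀ a b c n v → Dec (TriSol a b c n v)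
  tri? a b c n (x , y , z) = _ ℤ.≟ _

  count-tri : ∀ a b c n → 1 ℕ.≤ a → 1 ℕ.≤ b → 1 ℕ.≤ c → Σ ℕ (t≡ a b c n)
  count-tri a b c n ha hb hc =
    count-covered _≟³_ (tri? a b c n) (tri-irrelevant a b c n) (tri-candidates a b c n) (tri-cover n ha hb hc)

  count-tri-even : ∀ a b c n → 1 ℕ.≤ a → 1 ℕ.≤ b → 1 ℕ.≤ c →
                   Σ ℕ λ k → Fin k ↔ Σ ℤ³ (TriSol a b c n ∩ EvenDiff)
  count-tri-even a b c n ha hb hc =
    count-covered _≟³_ (λ { v@(x , y , z) → tri? a b c n v ×-dec even? (x - y) })
      (∩-irrelevant (tri-irrelevant a b c n) even-diff-irrelevant) (tri-candidates a b c n)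
      (λ (p , _) → tri-cover n ha hb hc p)

module Cases where
  open import Data.Nat as ℕ using (ℕ)
  open import Data.Nat.Divisibility using (divides; m%n≡0⇒n∣m)
  open import Data.Integer using (+_)
  open import Data.Fin using (Fin)
  open import Data.Fin.Properties using (+↔⊎)
  open import Data.Product using (Σ; _×_; _,_)
  open import Data.Sum using (_⊎_)
  open import Data.Sum.Function.Propositional using (_⊎-↔_)
  open import Relation.Unary using (_∩_)
  open import Function.Bundles using (_↔_)
  open import Function.Construct.Identity using (↔-id)
  open import Function.Construct.Symmetry using (↔-sym)
  open import Function.Related.Propositional using (module EquationalReasoning; bijection)
  open import Relation.Binary.PropositionalEquality using (_≡_; refl)
  open FiniteSets
  open ResiduePatterns using (%-divisor)
  open Forms
  open SolutionSets
  open Counting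
  open EquationalReasoning {k = bijection}

  case₁ : ∀ a b c n → 1 ℕ.≤ a → 1 ℕ.≤ b → 1 ℕ.≤ c → a ℕ.% 2 ≡ 1 → b ℕ.% 2 ≡ 1 →
          (a ℕ.+ b ℕ.+ c) ℕ.% 4 ≡ 2 → c ℕ.% 8 ≡ 4 →
          Σ ℕ λ k → t≡ a b c n k × r≡ (h₁ a b c) (target a b c n) k
  case₁ a b c n ha hb hc a-odd b-odd S≡2 c≡4 =
    let k , enum = count-h₁ a b c ha hb hc (target a b c n)
    in k , (begin
             Fin k ↔⟨ enum ⟩
             Reps (h₁ a b c) (target a b c n) ↔⟨ ↔-sym (tri↔h₁ a b c n (odd-variables₁ a b c n a-odd b-odd c≡4 S≡2)) ⟩
             Tri a b c n ∎) , enum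

  case₂ : ∀ a b c n → 1 ℕ.≤ a → 1 ℕ.≤ b → 1 ℕ.≤ c → a ℕ.% 2 ≡ 1 → b ℕ.% 2 ≡ 1 → c ℕ.% 2 ≡ 0 →
          (a ℕ.+ b ℕ.+ c) ℕ.% 4 ≡ 2 →
          Σ ℕ λ k → t≡ a b c n k × r≡ (h₂ a b c) (target a b c n) k
  case₂ a b c n ha hb hc a-odd b-odd c-even S≡2 =
    let k , enum = count-tri a b c n ha hb hc
    in k , enum , (begin
             Fin k ↔⟨ enum ⟩
             Tri a b c n ↔⟨ tri↔h₂ a b c n (odd-variables₂ a b c n a-odd b-odd c-even S≡2) ⟩
             Reps (h₂ a b c) (target a b c n) ∎)

  -- In cases 3 and 4 every triangular solution with x - y odd is paired with
  -- one with x - y even, which in turn corresponds to one representation.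
  doubled-count : ∀ a b c n k → Fin k ↔ Σ ℤ³ (TriSol a b c n ∩ EvenDiff) → t≡ a b c n (2 ℕ.* k)
  doubled-count a b c n k enum = begin
    Fin (2 ℕ.* k)                                                          ↔⟨ Fin-double k ⟩
    (Fin k ⊎ Fin k)                                                        ↔⟨ enum ⊎-↔ enum ⟩
    (Σ ℤ³ (TriSol a b c n ∩ EvenDiff) ⊎ Σ ℤ³ (TriSol a b c n ∩ EvenDiff))  ↔⟨ ↔-id _ ⊎-↔ ↔-sym (tri-odd↔tri-even a b c n) ⟩
    (Σ ℤ³ (TriSol a b c n ∩ EvenDiff) ⊎ Σ ℤ³ (TriSol a b c n ∩ OddDiff))   ↔⟨ ↔-sym (tri-split a b c n) ⟩
    Tri a b c n                                                            ∎

  case₃ : ∀ a b c n → 1 ℕ.≤ a → 1 ℕ.≤ b → 1 ℕ.≤ c → a ℕ.% 2 ≡ 1 → b ℕ.% 2 ≡ 1 →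
          (a ℕ.+ b ℕ.+ c) ℕ.% 8 ≡ 4 → c ℕ.% 4 ≡ 2 →
          Σ ℕ λ k → t≡ a b c n (2 ℕ.* k) × r≡ (h₃ a b c) (target a b c n) k
  case₃ a b c n ha hb hc a-odd b-odd S≡4 c≡2 =
    let k , enum = count-tri-even a b c n ha hb hc
    in k , doubled-count a b c n k enum , (begin
             Fin k ↔⟨ enum ⟩
             Σ ℤ³ (TriSol a b c n ∩ EvenDiff) ↔⟨ tri-even↔h₃ a b c n (odd-variables₃ a b c n a-odd b-odd c≡2 S≡4) ⟩
             Reps (h₃ a b c) (target a b c n) ∎)

  case₄ : ∀ a b c n → 1 ℕ.≤ a → 1 ℕ.≤ b → 1 ℕ.≤ c → a ℕ.% 2 ≡ 1 → b ℕ.% 2 ≡ 1 →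
          (a ℕ.+ b ℕ.+ c) ℕ.% 8 ≡ 4 → c ℕ.% 4 ≡ 0 →
          Σ ℕ λ k → t≡ a b c n (2 ℕ.* k) × r≡ (h₄ a b c) (target a b c n) k
  case₄ a b c n ha hb hc a-odd b-odd S≡4 c≡0 =
    let k , enum = count-tri-even a b c n ha hb hc
    in k , doubled-count a b c n k enum , (begin
             Fin k ↔⟨ enum ⟩
             Σ ℤ³ (TriSol a b c n ∩ EvenDiff) ↔⟨ tri-even↔h₄ a b c n (odd-variables₄ a b c n a-odd b-odd c≡0 S≡4) ⟩
             Reps (h₄ a b c) (target a b c n) ∎)

  case₅ : ∀ a b c n → 1 ℕ.≤ a → 1 ℕ.≤ b → 1 ℕ.≤ c → (a ℕ.+ b ℕ.+ c) ℕ.% 8 ≡ 0 →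
          Σ ℕ λ k₁ → Σ ℕ λ k₂ → Σ ℕ λ t →
            r≡ (h₅ a b c) (target a b c n) k₁ × r≡ (h₁ a b c) (+ (2 ℕ.* n ℕ.+ (a ℕ.+ b ℕ.+ c) ℕ./ 4)) k₂
            × t≡ a b c n t × k₁ ≡ t ℕ.+ k₂
  case₅ a b c n ha hb hc S≡0 =
    let m′ = + (2 ℕ.* n ℕ.+ (a ℕ.+ b ℕ.+ c) ℕ./ 4)
        t , enum-tri = count-tri a b c n ha hb hc
        k , enum-rep = count-h₁ a b c ha hb hc m′
        4∣S = m%n≡0⇒n∣m (a ℕ.+ b ℕ.+ c) 4 (%-divisor {a ℕ.+ b ℕ.+ c} {0} 4 8 (divides 2 refl) S≡0)
    in t ℕ.+ k , k , t , (begin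
         Fin (t ℕ.+ k)                           ↔⟨ +↔⊎ ⟩
         (Fin t ⊎ Fin k)                         ↔⟨ enum-tri ⊎-↔ enum-rep ⟩
         (Tri a b c n ⊎ Reps (h₁ a b c) m′)      ↔⟨ tri↔h₅-odd a b c n ⊎-↔ h₁↔h₅-even a b c (target-quarter a b c n 4∣S) ⟩
         (Σ ℤ³ ((λ v → h₅ a b c v ≡ target a b c n) ∩ OddHead) ⊎ Σ ℤ³ ((λ v → h₅ a b c v ≡ target a b c n) ∩ EvenHead))
                                                 ↔⟨ ↔-sym (h₅-split a b c (target a b c n)) ⟩
         Reps (h₅ a b c) (target a b c n)        ∎) , enum-rep , enum-tri , refl

open import Data.Nat using (ℕ; _+_; _*_; _%_; _/_; _≤_)
open import Data.Nat.GCD using (gcd)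
open import Data.Integer using (+_)
open import Data.Product using (Σ; _×_; _,_)
open import Relation.Binary.PropositionalEquality using (_≡_; _≢_)

-- The hypotheses gcd(a, b, c) = 1 and n ≥ 1, and c ≢ 4 (mod 8) in the second
-- case, are not needed for the identities.
lemma2p2 : (a b c : ℕ) → 1 ≤ a → 1 ≤ b → 1 ≤ c → gcd a (gcd b c) ≡ 1 →
    a % 2 ≡ 1 → b % 2 ≡ 1 → c % 2 ≡ 0 → (n : ℕ) → 1 ≤ n →
    ((a + b + c) % 4 ≡ 2 → c % 8 ≡ 4 →
      Σ ℕ λ k → t≡ a b c n k × r≡ (h₁ a b c) (+ (8 * n + (a + b + c))) k)
    × ((a + b + c) % 4 ≡ 2 → c % 8 ≢ 4 →
      Σ ℕ λ k → t≡ a b c n k × r≡ (h₂ a b c) (+ (8 * n + (a + b + c))) k)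
    × ((a + b + c) % 8 ≡ 4 → c % 4 ≡ 2 →
      Σ ℕ λ k → t≡ a b c n (2 * k) × r≡ (h₃ a b c) (+ (8 * n + (a + b + c))) k)
    × ((a + b + c) % 8 ≡ 4 → c % 4 ≡ 0 →
      Σ ℕ λ k → t≡ a b c n (2 * k) × r≡ (h₄ a b c) (+ (8 * n + (a + b + c))) k)
    × ((a + b + c) % 8 ≡ 0 →
      Σ ℕ λ k₁ → Σ ℕ λ k₂ → Σ ℕ λ t →
        r≡ (h₅ a b c) (+ (8 * n + (a + b + c))) k₁
        × r≡ (h₁ a b c) (+ (2 * n + (a + b + c) / 4)) k₂
        × t≡ a b c n t
        × k₁ ≡ t + k₂)
lemma2p2 a b c ha hb hc _ a-odd b-odd c-even n _ =
  (λ S≡2 c≡4 → Cases.case₁ a b c n ha hb hc a-odd b-odd S≡2 c≡4) ,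
  (λ S≡2 _   → Cases.case₂ a b c n ha hb hc a-odd b-odd c-even S≡2) ,
  (λ S≡4 c≡2 → Cases.case₃ a b c n ha hb hc a-odd b-odd S≡4 c≡2) ,
  (λ S≡4 c≡0 → Cases.case₄ a b c n ha hb hc a-odd b-odd S≡4 c≡0) ,
  (λ S≡0     → Cases.case₅ a b c n ha hb hc S≡0)
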